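{- Let $\beta(k)$ be defined as in the context. Then $$\beta(2)=4,\qquad \beta(3)=6,\qquad 7\le \beta(4)\le 8,\qquad 8\le \beta(5)\le 10.$$
   Context: For positive integers $k, s_1, s_2$ consider the diophantine system $$\sum_{i=1}^{s_1} x_i^r=\sum_{i=1}^{s_2} y_i^r,\qquad r=1,2,\ldots,k,$$ in integers $x_1,\dots,x_{s_1},y_1,\dots,y_{s_2}$. Arrange (by interchanging the two sides if necessary) that $s_1\le s_2$. A solution is called trivial if $y_i=0$ for $s_2-s_1$ values of $i$ and the remaining $s_1$ integers $y_i$ are a permutation of $x_1,\dots,x_{s_1}$; otherwise it is nontrivial. $\beta(k)$ denotes the minimum value of $s_1+s_2$ (over all positive integers $s_1,s_2$) for which this system has a nontrivial integer solution. -}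

module Defs where

open import Data.Nat using (ℕ; zero; suc; _≤_; _<_; _∸_; _+_)
open import Data.Integer using (ℤ; 0ℤ; _^_) renaming (_+_ to _+ℤ_)
open import Data.Fin using (Fin)
open import Data.List using (List; _++_; replicate)
open import Data.Vec.Functional using (toList; foldr; map)
open import Data.List.Relation.Binary.Permutation.Propositional using (_↭_)
open import Data.Product using (_×_; Σ; ∃-syntax)
open import Relation.Nullary using (¬_)
open import Relation.Binary.PropositionalEquality using (_≡_)

powSum : {s : ℕ} → (Fin s → ℤ) → ℕ → ℤ
powSum x r = foldr _+ℤ_ 0ℤ (map (λ a → a ^ r) x)

IsSolution : (k : ℕ) {s₁ s₂ : ℕ} → (Fin s₁ → ℤ) → (Fin s₂ → ℤ) → Set
IsSolution k x y = ∀ r → 1 ≤ r → r ≤ k → powSum x r ≡ powSum y r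

-- Trivial with x on the shorter side (a ≤ b): y consists of (b ∸ a) zeros
-- together with a permutation of x.
TrivialOrdered : {a b : ℕ} → (Fin a → ℤ) → (Fin b → ℤ) → Set
TrivialOrdered {a} {b} x y = toList y ↭ (toList x ++ replicate (b ∸ a) 0ℤ)

Nontrivial : {s₁ s₂ : ℕ} → (Fin s₁ → ℤ) → (Fin s₂ → ℤ) → Set
Nontrivial {s₁} {s₂} x y =
  (s₁ ≤ s₂ → ¬ TrivialOrdered x y) × (s₂ < s₁ → ¬ TrivialOrdered y x)

HasNontrivialSolution : ℕ → ℕ → ℕ → Set
HasNontrivialSolution k s₁ s₂ =
  Σ (Fin s₁ → ℤ) λ x → Σ (Fin s₂ → ℤ) λ y → IsSolution k x y × Nontrivial x y

IsBeta : ℕ → ℕ → Set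
IsBeta k n =
  (∃[ s₁ ] ∃[ s₂ ] (1 ≤ s₁ × 1 ≤ s₂ × s₁ + s₂ ≡ n × HasNontrivialSolution k s₁ s₂))
  × (∀ s₁ s₂ → 1 ≤ s₁ → 1 ≤ s₂ → HasNontrivialSolution k s₁ s₂ → n ≤ s₁ + s₂)

-- The upper bounds are explicit solutions with s₁ + s₂ = 2k; the lower bound
-- β(k) ≥ 2k holds for every k. Suppose x (s₁ entries) and y (s₂ ≥ s₁ entries) have equal power
-- sums of degree 1, …, k and s₁ + s₂ < 2k. Newton's identities give equal elementary symmetric
-- functions e_j(x) = e_j(y) for j ≤ k, so e_j(y) = 0 both for s₁ < j ≤ k and for j > s₂. From
-- ∏ (1 − y t)(1 + y t) = ∏ (1 − y² t²) we get e_k(y²) = Σ_{i+j=2k} ± e_i(y) e_j(y), and on that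
-- antidiagonal every term has a vanishing factor. The y² are nonnegative, so fewer than k of the
-- y are nonzero; hence e_j(x) = e_j(y) for all j, x padded with zeros has the same characteristic
-- polynomial as y, and the solution is trivial.

module Submission where

open import Defs
open import Data.Fin using (Fin)
import Data.Fin as Fin
open import Data.Integer using (ℤ; 0ℤ; 1ℤ; +_; -[1+_]; -_; _+_; _-_; _*_; _^_; ∣_∣)
import Data.Integer.Properties as ℤ
open import Algebra.Properties.AbelianGroup ℤ.+-0-abelianGroup using (inverseˡ-unique)
open import Data.Integer.Tactic.RingSolver using (solve-∀)
open import Data.List using (List; []; _∷_; length; _++_; map; replicate)
open import Data.List.Properties using (length-++; length-replicate; length-tabulate; tabulate-lookup)
open import Data.List.Membership.Propositional using (_∈_; _∉_)
open import Data.List.Membership.Propositional.Properties using (∈-∃++)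
open import Data.List.Membership.DecPropositional ℤ._≟_ using (_∈?_)
open import Data.List.Relation.Unary.Any using (here; there)
import Data.List.Relation.Binary.Permutation.Propositional as ↭
open ↭ using (_↭_; prep; ↭-sym; ↭-trans)
open import Data.List.Relation.Binary.Permutation.Propositional.Properties
  using (↭-length; ++-comm; ∈-resp-↭) renaming (shift to ↭-shift)
open import Data.Nat as ℕ using (ℕ; zero; suc; z≤n; s≤s; _∸_; _≤_; _<_)
import Data.Nat.Properties as ℕ
open import Data.Product using (_×_; _,_; ∃-syntax)
open import Data.Sum using (_⊎_; inj₁; inj₂; [_,_]′; map₂)
open import Data.Vec.Functional using (toList; fromList)
open import Function using (_∘_)
open import Relation.Nullary using (¬_; yes; no; contradiction)
open import Relation.Nullary.Decidable using (True; False; toWitness; toWitnessFalse)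
open import Relation.Binary.PropositionalEquality
open ≡-Reasoning

-- Cauchy products of integer sequences

δ : ℕ → ℤ
δ zero    = 1ℤ
δ (suc _) = 0ℤ

shift : (ℕ → ℤ) → ℕ → ℤ
shift f zero    = 0ℤ
shift f (suc n) = f n

shift-cong : ∀ {f g} → f ≗ g → shift f ≗ shift g
shift-cong f≗g zero    = refl
shift-cong f≗g (suc n) = f≗g n

-- (f ⋆ g) n = Σ_{i+j=n} f i * g j
infixl 7 _⋆_

_⋆_ : (ℕ → ℤ) → (ℕ → ℤ) → ℕ → ℤ
(f ⋆ g) zero    = f 0 * g 0
(f ⋆ g) (suc n) = f 0 * g (suc n) + (f ∘ suc ⋆ g) n

⋆-cong-≤ : ∀ {f f′ g g′} n → (∀ i → i ≤ n → f i ≡ f′ i) → (∀ i → i ≤ n → g i ≡ g′ i) →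
           (f ⋆ g) n ≡ (f′ ⋆ g′) n
⋆-cong-≤ zero    f≡ g≡ = cong₂ _*_ (f≡ 0 z≤n) (g≡ 0 z≤n)
⋆-cong-≤ (suc n) f≡ g≡ =
  cong₂ _+_ (cong₂ _*_ (f≡ 0 z≤n) (g≡ (suc n) ℕ.≤-refl))
            (⋆-cong-≤ n (λ i i≤n → f≡ (suc i) (s≤s i≤n)) (λ i i≤n → g≡ i (ℕ.m≤n⇒m≤1+n i≤n)))

i≡0∨j≡0⇒i*j≡0 : ∀ {x y} → x ≡ 0ℤ ⊎ y ≡ 0ℤ → x * y ≡ 0ℤ
i≡0∨j≡0⇒i*j≡0 {y = y} (inj₁ refl) = ℤ.*-zeroˡ y
i≡0∨j≡0⇒i*j≡0 {x = x} (inj₂ refl) = ℤ.*-zeroʳ x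

⋆-vanish : ∀ {f g} n → (∀ i j → i ℕ.+ j ≡ n → f i ≡ 0ℤ ⊎ g j ≡ 0ℤ) → (f ⋆ g) n ≡ 0ℤ
⋆-vanish zero    f⊎g = i≡0∨j≡0⇒i*j≡0 (f⊎g 0 0 refl)
⋆-vanish (suc n) f⊎g =
  cong₂ _+_ (i≡0∨j≡0⇒i*j≡0 (f⊎g 0 (suc n) refl))
            (⋆-vanish n (λ i j i+j≡n → f⊎g (suc i) j (cong suc i+j≡n)))

⋆-identityˡ : ∀ g n → (δ ⋆ g) n ≡ g n
⋆-identityˡ g zero    = ℤ.*-identityˡ (g 0)
⋆-identityˡ g (suc n) =
  trans (cong₂ _+_ (ℤ.*-identityˡ (g (suc n))) (⋆-vanish n (λ _ _ _ → inj₁ refl)))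
        (ℤ.+-identityʳ (g (suc n)))

⋆-shiftˡ : ∀ f g n → (shift f ⋆ g) n ≡ shift (f ⋆ g) n
⋆-shiftˡ f g zero    = ℤ.*-zeroˡ (g 0)
⋆-shiftˡ f g (suc n) =
  trans (cong (_+ (f ⋆ g) n) (ℤ.*-zeroˡ (g (suc n)))) (ℤ.+-identityˡ ((f ⋆ g) n))

⋆-linearˡ : ∀ a f f′ g n → ((λ i → f i - a * f′ i) ⋆ g) n ≡ (f ⋆ g) n - a * (f′ ⋆ g) n
⋆-linearˡ a f f′ g zero    = distrib a (f 0) (f′ 0) (g 0)
  where
  distrib : ∀ a x y z → (x - a * y) * z ≡ x * z - a * (y * z)
  distrib = solve-∀
⋆-linearˡ a f f′ g (suc n) =
  trans (cong (_+_ ((f 0 - a * f′ 0) * g (suc n))) (⋆-linearˡ a (f ∘ suc) (f′ ∘ suc) g n))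
        (distrib a (f 0) (f′ 0) (g (suc n)) ((f ∘ suc ⋆ g) n) ((f′ ∘ suc ⋆ g) n))
  where
  distrib : ∀ a x y z u v → (x - a * y) * z + (u - a * v) ≡ (x * z + u) - a * (y * z + v)
  distrib = solve-∀

⋆-distribˡ-+ : ∀ f g h n → (f ⋆ (λ i → g i + h i)) n ≡ (f ⋆ g) n + (f ⋆ h) n
⋆-distribˡ-+ f g h zero    = ℤ.*-distribˡ-+ (f 0) (g 0) (h 0)
⋆-distribˡ-+ f g h (suc n) =
  trans (cong (_+_ (f 0 * (g (suc n) + h (suc n)))) (⋆-distribˡ-+ (f ∘ suc) g h n))
        (distrib (f 0) (g (suc n)) (h (suc n)) ((f ∘ suc ⋆ g) n) ((f ∘ suc ⋆ h) n))
  where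
  distrib : ∀ x y z u v → x * (y + z) + (u + v) ≡ (x * y + u) + (x * z + v)
  distrib = solve-∀

⋆-scaleʳ : ∀ a f g n → (f ⋆ (λ i → a * g i)) n ≡ a * (f ⋆ g) n
⋆-scaleʳ a f g zero    = commute a (f 0) (g 0)
  where
  commute : ∀ a x y → x * (a * y) ≡ a * (x * y)
  commute = solve-∀
⋆-scaleʳ a f g (suc n) =
  trans (cong (_+_ (f 0 * (a * g (suc n)))) (⋆-scaleʳ a (f ∘ suc) g n))
        (distrib a (f 0) (g (suc n)) ((f ∘ suc ⋆ g) n))
  where
  distrib : ∀ a x y u → x * (a * y) + a * u ≡ a * (x * y + u)
  distrib = solve-∀

⋆-horner : ∀ t f n → (f ⋆ (t ^_)) (suc n) ≡ t * (f ⋆ (t ^_)) n + f (suc n)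
⋆-horner t f zero    = step t (f 0) (f 1)
  where
  step : ∀ t x y → x * (t * 1ℤ) + y * 1ℤ ≡ t * (x * 1ℤ) + y
  step = solve-∀
⋆-horner t f (suc n) =
  trans (cong (_+_ (f 0 * t ^ suc (suc n))) (⋆-horner t (f ∘ suc) n))
        (step t (f 0) (t ^ suc n) ((f ∘ suc ⋆ (t ^_)) n) (f (suc (suc n))))
  where
  step : ∀ t x p u y → x * (t * p) + (t * u + y) ≡ t * (x * p + u) + y
  step = solve-∀

-- Elementary symmetric functions and Newton's identities

-- esym L n is the coefficient of tⁿ in ∏_{a ∈ L} (1 − a t), that is (−1)ⁿ e_n(L).
esym : List ℤ → ℕ → ℤ
esym []      = δ
esym (a ∷ L) n = esym L n - a * shift (esym L) n

esym-0 : ∀ L → esym L 0 ≡ 1ℤ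
esym-0 []      = refl
esym-0 (a ∷ L) = trans (cong (_- a * 0ℤ) (esym-0 L)) (cong (_-_ 1ℤ) (ℤ.*-zeroʳ a))

esym-beyond-length : ∀ L {n} → length L < n → esym L n ≡ 0ℤ
esym-beyond-length []      {suc n} _           = refl
esym-beyond-length (a ∷ L) {suc n} (s≤s |L|<n) =
  trans (cong₂ (λ u v → u - a * v) (esym-beyond-length L (ℕ.m<n⇒m<1+n |L|<n))
                                    (esym-beyond-length L |L|<n))
        (cong (_-_ 0ℤ) (ℤ.*-zeroʳ a))

psum : List ℤ → ℕ → ℤ
psum []      r = 0ℤ
psum (a ∷ L) r = a ^ r + psum L r

newton-identity : ∀ L n → + suc n * esym L (suc n) + (esym L ⋆ (psum L ∘ suc)) n ≡ 0ℤ
newton-identity []      n = cong₂ _+_ (ℤ.*-zeroʳ (+ suc n)) (⋆-vanish n (λ _ _ _ → inj₂ refl))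
newton-identity (a ∷ L) zero =
  trans (step a (esym L 0) (esym L 1) (psum L 1)) (newton-identity L 0)
  where
  step : ∀ a e₀ e₁ p → + 1 * (e₁ - a * e₀) + (e₀ - a * 0ℤ) * (a * 1ℤ + p) ≡ + 1 * e₁ + e₀ * p
  step = solve-∀
newton-identity (a ∷ L) (suc m) = begin
  lead + (esym (a ∷ L) ⋆ P′) (suc m)
    ≡⟨ cong (_+_ lead) (⋆-linearˡ a c (shift c) P′ (suc m)) ⟩
  lead + ((c ⋆ P′) (suc m) - a * (shift c ⋆ P′) (suc m))
    ≡⟨ cong₂ (λ u v → lead + (u - a * v))
             (trans (conv-P′ (suc m)) (cong (λ h → a * h + (c ⋆ P) (suc m)) (⋆-horner a c m)))
             (trans (⋆-shiftˡ c P′ (suc m)) (conv-P′ m)) ⟩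
  lead + ((a * (a * H m + c (suc m)) + (c ⋆ P) (suc m)) - a * (a * H m + (c ⋆ P) m))
    ≡⟨ step (+ suc m) a (c (suc (suc m))) (c (suc m)) (H m) ((c ⋆ P) (suc m)) ((c ⋆ P) m) ⟩
  (+ suc (suc m) * c (suc (suc m)) + (c ⋆ P) (suc m)) - a * (+ suc m * c (suc m) + (c ⋆ P) m)
    ≡⟨ cong₂ (λ u v → u - a * v) (newton-identity L (suc m)) (newton-identity L m) ⟩
  0ℤ - a * 0ℤ
    ≡⟨ cong (_-_ 0ℤ) (ℤ.*-zeroʳ a) ⟩
  0ℤ ∎
  where
  c : ℕ → ℤ
  c = esym L
  lead : ℤ
  lead = + suc (suc m) * (c (suc (suc m)) - a * c (suc m))
  P : ℕ → ℤ
  P = psum L ∘ suc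
  P′ : ℕ → ℤ
  P′ = psum (a ∷ L) ∘ suc
  H : ℕ → ℤ
  H = c ⋆ (a ^_)
  conv-P′ : ∀ n → (c ⋆ P′) n ≡ a * H n + (c ⋆ P) n
  conv-P′ n = trans (⋆-distribˡ-+ c (λ i → a * a ^ i) P n)
                    (cong (_+ (c ⋆ P) n) (⋆-scaleʳ a c (a ^_) n))
  step : ∀ k a c₂ c₁ h q₁ q₀ →
         (1ℤ + k) * (c₂ - a * c₁) + ((a * (a * h + c₁) + q₁) - a * (a * h + q₀)) ≡
         ((1ℤ + k) * c₂ + q₁) - a * (k * c₁ + q₀)
  step = solve-∀

PowerSumsAgree : ℕ → List ℤ → List ℤ → Set
PowerSumsAgree k X Y = ∀ r → 1 ≤ r → r ≤ k → psum X r ≡ psum Y r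

esym-agree : ∀ {k} X Y → PowerSumsAgree k X Y → ∀ j → j ≤ k → esym X j ≡ esym Y j
esym-agree {k} X Y p≡ j j≤k = agree-below j j≤k j ℕ.≤-refl
  where
  agree-below : ∀ j → j ≤ k → ∀ i → i ≤ j → esym X i ≡ esym Y i
  agree-below j       _   zero    _ = trans (esym-0 X) (sym (esym-0 Y))
  agree-below (suc j) j<k (suc i) (s≤s i≤j) with ℕ.m≤n⇒m<n∨m≡n i≤j
  ... | inj₁ i<j  = agree-below j (ℕ.<⇒≤ j<k) (suc i) i<j
  ... | inj₂ refl = ℤ.*-cancelˡ-≡ (+ suc i) (esym X (suc i)) (esym Y (suc i))
    (trans (inverseˡ-unique _ _ (newton-identity X i))
           (trans (cong -_ conv≡) (sym (inverseˡ-unique _ _ (newton-identity Y i)))))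
    where
    conv≡ : (esym X ⋆ (psum X ∘ suc)) i ≡ (esym Y ⋆ (psum Y ∘ suc)) i
    conv≡ = ⋆-cong-≤ i (agree-below i (ℕ.<⇒≤ j<k))
                       (λ r r≤i → p≡ (suc r) (s≤s z≤n) (ℕ.≤-trans (s≤s r≤i) j<k))

-- Elementary symmetric functions determine a list up to permutation

esym-∷-cong : ∀ a X Y → esym X ≗ esym Y → esym (a ∷ X) ≗ esym (a ∷ Y)
esym-∷-cong a X Y e≗ n = cong₂ (λ u v → u - a * v) (e≗ n) (shift-cong e≗ n)

esym-swap : ∀ x y L → esym (x ∷ y ∷ L) ≗ esym (y ∷ x ∷ L)
esym-swap x y L zero    = swap₀ x y (esym L 0)
  where
  swap₀ : ∀ x y a → (a - y * 0ℤ) - x * 0ℤ ≡ (a - x * 0ℤ) - y * 0ℤ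
  swap₀ = solve-∀
esym-swap x y L (suc n) = swap₁ x y (esym L (suc n)) (esym L n) (shift (esym L) n)
  where
  swap₁ : ∀ x y a b c → (a - y * b) - x * (b - y * c) ≡ (a - x * b) - y * (b - x * c)
  swap₁ = solve-∀

esym-↭ : ∀ {X Y} → X ↭ Y → esym X ≗ esym Y
esym-↭ ↭.refl                                    n = refl
esym-↭ {a ∷ X}     {a ∷ Y}     (prep a p)         = esym-∷-cong a X Y (esym-↭ p)
esym-↭ {x ∷ y ∷ X} {y ∷ x ∷ Y} (↭.swap x y p)   n =
  trans (esym-swap x y X n) (esym-∷-cong y (x ∷ X) (x ∷ Y) (esym-∷-cong x X Y (esym-↭ p)) n)
esym-↭                         (↭.trans p q)    n = trans (esym-↭ p n) (esym-↭ q n)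

esym-∷-cancel : ∀ a X Y → esym (a ∷ X) ≗ esym (a ∷ Y) → esym X ≗ esym Y
esym-∷-cancel a X Y e≗ zero    = trans (esym-0 X) (sym (esym-0 Y))
esym-∷-cancel a X Y e≗ (suc n) = begin
  esym X (suc n)                            ≡⟨ restore a (esym X (suc n)) (esym X n) ⟩
  (esym X (suc n) - a * esym X n) + a * esym X n
    ≡⟨ cong₂ (λ u v → u + a * v) (e≗ (suc n)) (esym-∷-cancel a X Y e≗ n) ⟩
  (esym Y (suc n) - a * esym Y n) + a * esym Y n ≡⟨ sym (restore a (esym Y (suc n)) (esym Y n)) ⟩
  esym Y (suc n)                            ∎
  where
  restore : ∀ a u v → u ≡ (u - a * v) + a * v
  restore = solve-∀

charPoly : List ℤ → ℤ → ℤ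
charPoly []      t = 1ℤ
charPoly (a ∷ L) t = (t - a) * charPoly L t

charPoly-esym : ∀ L t → (esym L ⋆ (t ^_)) (length L) ≡ charPoly L t
charPoly-esym []      t = refl
charPoly-esym (a ∷ L) t = begin
  (esym (a ∷ L) ⋆ (t ^_)) (suc n)                      ≡⟨ ⋆-linearˡ a c (shift c) (t ^_) (suc n) ⟩
  (c ⋆ (t ^_)) (suc n) - a * (shift c ⋆ (t ^_)) (suc n)
    ≡⟨ cong₂ (λ u v → u - a * v) (⋆-horner t c n) (⋆-shiftˡ c (t ^_) (suc n)) ⟩
  (t * (c ⋆ (t ^_)) n + c (suc n)) - a * (c ⋆ (t ^_)) n
    ≡⟨ cong₂ (λ u v → (t * u + v) - a * u) (charPoly-esym L t) (esym-beyond-length L ℕ.≤-refl) ⟩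
  (t * charPoly L t + 0ℤ) - a * charPoly L t          ≡⟨ factor t a (charPoly L t) ⟩
  (t - a) * charPoly L t                               ∎
  where
  c : ℕ → ℤ
  c = esym L
  n : ℕ
  n = length L
  factor : ∀ t a p → (t * p + 0ℤ) - a * p ≡ (t - a) * p
  factor = solve-∀

charPoly-root⇒∈ : ∀ L t → charPoly L t ≡ 0ℤ → t ∈ L
charPoly-root⇒∈ (a ∷ L) t χ≡0 with ℤ.i*j≡0⇒i≡0∨j≡0 (t - a) χ≡0
... | inj₁ t-a≡0 = here (ℤ.i-j≡0⇒i≡j t a t-a≡0)
... | inj₂ χ′≡0  = there (charPoly-root⇒∈ L t χ′≡0)

esym-injective : ∀ X Y → length X ≡ length Y → esym X ≗ esym Y → X ↭ Y
esym-injective []      []      _       _  = ↭.refl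
esym-injective X       (y ∷ Y) |X|≡|Y| e≗ with ∈-∃++ (charPoly-root⇒∈ X y y-root)
  where
  y-root : charPoly X y ≡ 0ℤ
  y-root = begin
    charPoly X y                               ≡⟨ charPoly-esym X y ⟨
    (esym X ⋆ (y ^_)) (length X)               ≡⟨ cong (esym X ⋆ (y ^_)) |X|≡|Y| ⟩
    (esym X ⋆ (y ^_)) (suc (length Y))
      ≡⟨ ⋆-cong-≤ (suc (length Y)) (λ i _ → e≗ i) (λ _ _ → refl) ⟩
    (esym (y ∷ Y) ⋆ (y ^_)) (suc (length Y))   ≡⟨ charPoly-esym (y ∷ Y) y ⟩
    (y - y) * charPoly Y y                     ≡⟨ cong (_* charPoly Y y) (ℤ.+-inverseʳ y) ⟩
    0ℤ * charPoly Y y                          ≡⟨ ℤ.*-zeroˡ (charPoly Y y) ⟩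
    0ℤ                                         ∎
... | as , bs , refl =
  ↭-trans (↭-shift y as bs)
          (prep y (esym-injective (as ++ bs) Y |as++bs|≡|Y| (esym-∷-cancel y (as ++ bs) Y e≗′)))
  where
  |as++bs|≡|Y| : length (as ++ bs) ≡ length Y
  |as++bs|≡|Y| = ℕ.suc-injective (trans (sym (↭-length (↭-shift y as bs))) |X|≡|Y|)
  e≗′ : esym (y ∷ as ++ bs) ≗ esym (y ∷ Y)
  e≗′ n = trans (esym-↭ (↭-sym (↭-shift y as bs)) n) (e≗ n)

-- The squaring trick

esym-++ : ∀ X Y → esym (X ++ Y) ≗ esym X ⋆ esym Y
esym-++ []      Y n = sym (⋆-identityˡ (esym Y) n)
esym-++ (a ∷ X) Y n = begin
  esym (X ++ Y) n - a * shift (esym (X ++ Y)) n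
    ≡⟨ cong₂ (λ u v → u - a * v) (esym-++ X Y n) (shift-cong (esym-++ X Y) n) ⟩
  (esym X ⋆ esym Y) n - a * shift (esym X ⋆ esym Y) n
    ≡⟨ cong (λ v → (esym X ⋆ esym Y) n - a * v) (⋆-shiftˡ (esym X) (esym Y) n) ⟨
  (esym X ⋆ esym Y) n - a * (shift (esym X) ⋆ esym Y) n
    ≡⟨ ⋆-linearˡ a (esym X) (shift (esym X)) (esym Y) n ⟨
  (esym (a ∷ X) ⋆ esym Y) n ∎

esym-++-zeros : ∀ L m → esym (L ++ replicate m 0ℤ) ≗ esym L
esym-++-zeros L m n = trans (esym-↭ (++-comm L (replicate m 0ℤ)) n) (drop-zeros m n)
  where
  drop-zeros : ∀ m → esym (replicate m 0ℤ ++ L) ≗ esym L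
  drop-zeros zero    n = refl
  drop-zeros (suc m) n =
    trans (cong (_-_ (esym Z n)) (ℤ.*-zeroˡ (shift (esym Z) n)))
          (trans (ℤ.+-identityʳ (esym Z n)) (drop-zeros m n))
    where
    Z : List ℤ
    Z = replicate m 0ℤ ++ L

esym-neg : ∀ L n → esym (map -_ L) n ≡ (- 1ℤ) ^ n * esym L n
esym-neg []      zero    = refl
esym-neg []      (suc n) = sym (ℤ.*-zeroʳ ((- 1ℤ) ^ suc n))
esym-neg (a ∷ L) zero    = trans (cong (λ u → u - - a * 0ℤ) (esym-neg L 0)) (step a (esym L 0))
  where
  step : ∀ a u → 1ℤ * u - - a * 0ℤ ≡ 1ℤ * (u - a * 0ℤ)
  step = solve-∀
esym-neg (a ∷ L) (suc n) =
  trans (cong₂ (λ u v → u - - a * v) (esym-neg L (suc n)) (esym-neg L n))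
        (step a ((- 1ℤ) ^ n) (esym L (suc n)) (esym L n))
  where
  step : ∀ a s u v → (- 1ℤ * s) * u - - a * (s * v) ≡ (- 1ℤ * s) * (u - a * v)
  step = solve-∀

squares : List ℤ → List ℤ
squares = map (λ y → y * y)

-- ∏ (1 − a t)(1 + a t) = ∏ (1 − a² t²)
esym-squares : ∀ L k → esym (squares L) k ≡ esym (L ++ map -_ L) (2 ℕ.* k)
esym-squares []      zero    = refl
esym-squares []      (suc k) = refl
esym-squares (a ∷ L) k =
  trans (step k) (sym (esym-↭ (prep a (↭-shift (- a) L (map -_ L))) (2 ℕ.* k)))
  where
  M : List ℤ
  M = L ++ map -_ L
  step : ∀ k → esym (squares (a ∷ L)) k ≡ esym (a ∷ - a ∷ M) (2 ℕ.* k)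
  step zero    = trans (cong (λ u → u - a * a * 0ℤ) (esym-squares L 0)) (step₀ a (esym M 0))
    where
    step₀ : ∀ a u → u - a * a * 0ℤ ≡ (u - - a * 0ℤ) - a * 0ℤ
    step₀ = solve-∀
  step (suc k) = begin
    esym (squares L) (suc k) - a * a * esym (squares L) k
      ≡⟨ cong₂ (λ u v → u - a * a * v) (trans (esym-squares L (suc k)) (cong (esym M) (ℕ.*-suc 2 k)))
                                        (esym-squares L k) ⟩
    esym M (2 ℕ.+ 2 ℕ.* k) - a * a * esym M (2 ℕ.* k)
      ≡⟨ step₁ a (esym M (2 ℕ.+ 2 ℕ.* k)) (esym M (suc (2 ℕ.* k))) (esym M (2 ℕ.* k)) ⟩
    esym (a ∷ - a ∷ M) (2 ℕ.+ 2 ℕ.* k)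
      ≡⟨ cong (esym (a ∷ - a ∷ M)) (ℕ.*-suc 2 k) ⟨
    esym (a ∷ - a ∷ M) (2 ℕ.* suc k) ∎
    where
    step₁ : ∀ a u v w → u - a * a * w ≡ (u - - a * v) - a * (v - - a * w)
    step₁ = solve-∀

esymℕ : List ℕ → ℕ → ℕ
esymℕ Z       zero    = 1
esymℕ []      (suc k) = 0
esymℕ (z ∷ Z) (suc k) = esymℕ Z (suc k) ℕ.+ z ℕ.* esymℕ Z k

abs² : ℤ → ℕ
abs² y = ∣ y ∣ ℕ.* ∣ y ∣

square≡abs² : ∀ y → y * y ≡ + abs² y
square≡abs² (+ n)    = sym (ℤ.pos-* n n)
square≡abs² -[1+ n ] = refl

esym-negSquares : ∀ Y k → esym (map -_ (squares Y)) k ≡ + esymℕ (map abs² Y) k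
esym-negSquares Y       zero    = esym-0 (map -_ (squares Y))
esym-negSquares []      (suc k) = refl
esym-negSquares (y ∷ Y) (suc k) = begin
  esym M (suc k) - - (y * y) * esym M k
    ≡⟨ cong₂ (λ u v → u - - (y * y) * v) (esym-negSquares Y (suc k)) (esym-negSquares Y k) ⟩
  + E (suc k) - - (y * y) * + E k                ≡⟨ step (+ E (suc k)) (y * y) (+ E k) ⟩
  + E (suc k) + y * y * + E k                    ≡⟨ cong (λ q → + E (suc k) + q * + E k) (square≡abs² y) ⟩
  + E (suc k) + + abs² y * + E k                 ≡⟨ cong (_+_ (+ E (suc k))) (ℤ.pos-* (abs² y) (E k)) ⟨
  + E (suc k) + + (abs² y ℕ.* E k)               ≡⟨ ℤ.pos-+ (E (suc k)) (abs² y ℕ.* E k) ⟨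
  + (E (suc k) ℕ.+ abs² y ℕ.* E k)               ∎
  where
  M : List ℤ
  M = map -_ (squares Y)
  E : ℕ → ℕ
  E = esymℕ (map abs² Y)
  step : ∀ u q v → u - - q * v ≡ u + q * v
  step = solve-∀

esymℕ-abs²≡0⇒esym≡0 : ∀ Y k → esymℕ (map abs² Y) k ≡ 0 → ∀ j → k ≤ j → esym Y j ≡ 0ℤ
esymℕ-abs²≡0⇒esym≡0 []      (suc k) _  (suc j) _       = refl
esymℕ-abs²≡0⇒esym≡0 (y ∷ Y) (suc k) E≡0 (suc j) (s≤s k≤j) =
  trans (cong₂ _-_ (esymℕ-abs²≡0⇒esym≡0 Y (suc k) (ℕ.m+n≡0⇒m≡0 _ E≡0) (suc j) (s≤s k≤j))
                   (i≡0∨j≡0⇒i*j≡0 y≡0⊎rest≡0))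
        (ℤ.+-identityˡ _)
  where
  y≡0⊎rest≡0 : y ≡ 0ℤ ⊎ esym Y j ≡ 0ℤ
  y≡0⊎rest≡0 with ℕ.m*n≡0⇒m≡0∨n≡0 (abs² y) (ℕ.m+n≡0⇒n≡0 (esymℕ (map abs² Y) (suc k)) E≡0)
  ... | inj₂ e≡0 = inj₂ (esymℕ-abs²≡0⇒esym≡0 Y k e≡0 j k≤j)
  ... | inj₁ y²≡0 with ℕ.m*n≡0⇒m≡0∨n≡0 ∣ y ∣ y²≡0
  ...   | inj₁ |y|≡0 = inj₁ (ℤ.∣i∣≡0⇒i≡0 |y|≡0)
  ...   | inj₂ |y|≡0 = inj₁ (ℤ.∣i∣≡0⇒i≡0 |y|≡0)

esym-squares≡0⇒esym≡0 : ∀ Y k → esym (squares Y) k ≡ 0ℤ → ∀ j → k ≤ j → esym Y j ≡ 0ℤ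
esym-squares≡0⇒esym≡0 Y k e≡0 = esymℕ-abs²≡0⇒esym≡0 Y k (ℤ.+-injective (begin
  + esymℕ (map abs² Y) k              ≡⟨ esym-negSquares Y k ⟨
  esym (map -_ (squares Y)) k         ≡⟨ esym-neg (squares Y) k ⟩
  (- 1ℤ) ^ k * esym (squares Y) k     ≡⟨ cong (_*_ ((- 1ℤ) ^ k)) e≡0 ⟩
  (- 1ℤ) ^ k * 0ℤ                     ≡⟨ ℤ.*-zeroʳ ((- 1ℤ) ^ k) ⟩
  0ℤ                                  ∎))

-- Short solutions are trivial

i≤a⇒a+b<i+j⇒b<j : ∀ {a b i j} → i ≤ a → a ℕ.+ b < i ℕ.+ j → b < j
i≤a⇒a+b<i+j⇒b<j {a} {b} {i} {j} i≤a ab<ij =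
  ℕ.+-cancelˡ-< i b j (ℕ.≤-<-trans (ℕ.+-monoˡ-≤ b i≤a) ab<ij)

i+j≡2k⇒i≤k⊎j≤k : ∀ {i j k} → i ℕ.+ j ≡ 2 ℕ.* k → i ≤ k ⊎ j ≤ k
i+j≡2k⇒i≤k⊎j≤k {i} {j} {k} i+j≡2k with i ℕ.≤? k
... | yes i≤k = inj₁ i≤k
... | no  i≰k = inj₂ (ℕ.<⇒≤ (ℕ.+-cancelˡ-< k j k k+j<k+k))
  where
  k+j<k+k : k ℕ.+ j < k ℕ.+ k
  k+j<k+k = subst (k ℕ.+ j <_) (trans i+j≡2k (cong (k ℕ.+_) (ℕ.+-identityʳ k)))
                  (ℕ.+-monoˡ-< j (ℕ.≰⇒> i≰k))

short-agreement⇒trivial : ∀ k X Y → length X ≤ length Y → length X ℕ.+ length Y < 2 ℕ.* k →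
                         PowerSumsAgree k X Y → Y ↭ X ++ replicate (length Y ∸ length X) 0ℤ
short-agreement⇒trivial k X Y a≤b ab<2k p≡ =
  ↭-sym (esym-injective (X ++ replicate (b ∸ a) 0ℤ) Y |padded|≡b
                        (λ n → trans (esym-++-zeros X (b ∸ a) n) (esym≗ n)))
  where
  a b : ℕ
  a = length X
  b = length Y
  agree : ∀ j → j ≤ k → esym X j ≡ esym Y j
  agree = esym-agree X Y p≡

  esymY≡0 : ∀ m → (a < m × m ≤ k) ⊎ b < m → esym Y m ≡ 0ℤ
  esymY≡0 m (inj₁ (a<m , m≤k)) = trans (sym (agree m m≤k)) (esym-beyond-length X a<m)
  esymY≡0 m (inj₂ b<m)         = esym-beyond-length Y b<m

  one-vanishes : ∀ i j → i ≤ k → i ℕ.+ j ≡ 2 ℕ.* k → esym Y i ≡ 0ℤ ⊎ esym Y j ≡ 0ℤ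
  one-vanishes i j i≤k i+j≡2k with a ℕ.<? i
  ... | yes a<i = inj₁ (esymY≡0 i (inj₁ (a<i , i≤k)))
  ... | no  a≮i = inj₂ (esymY≡0 j (inj₂ (i≤a⇒a+b<i+j⇒b<j (ℕ.≮⇒≥ a≮i)
                                      (subst (a ℕ.+ b <_) (sym i+j≡2k) ab<2k))))

  negated : ∀ {j} → esym Y j ≡ 0ℤ → esym (map -_ Y) j ≡ 0ℤ
  negated {j} e≡0 =
    trans (esym-neg Y j) (trans (cong (_*_ ((- 1ℤ) ^ j)) e≡0) (ℤ.*-zeroʳ ((- 1ℤ) ^ j)))

  squares≡0 : esym (squares Y) k ≡ 0ℤ
  squares≡0 = trans (esym-squares Y k) (trans (esym-++ Y (map -_ Y) (2 ℕ.* k))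
                (⋆-vanish (2 ℕ.* k) vanishing-pair))
    where
    vanishing-pair : ∀ i j → i ℕ.+ j ≡ 2 ℕ.* k → esym Y i ≡ 0ℤ ⊎ esym (map -_ Y) j ≡ 0ℤ
    vanishing-pair i j i+j≡2k with i+j≡2k⇒i≤k⊎j≤k i+j≡2k
    ... | inj₁ i≤k = map₂ negated (one-vanishes i j i≤k i+j≡2k)
    ... | inj₂ j≤k = [ inj₂ ∘ negated , inj₁ ]′ (one-vanishes j i j≤k (trans (ℕ.+-comm j i) i+j≡2k))

  a<k : a < k
  a<k = ℕ.*-cancelˡ-< 2 a k
          (ℕ.≤-<-trans (ℕ.+-monoʳ-≤ a (ℕ.≤-trans (ℕ.≤-reflexive (ℕ.+-identityʳ a)) a≤b)) ab<2k)

  esym≗ : esym X ≗ esym Y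
  esym≗ j with j ℕ.≤? k
  ... | yes j≤k = agree j j≤k
  ... | no  j≰k = trans (esym-beyond-length X (ℕ.<-trans a<k (ℕ.≰⇒> j≰k)))
                        (sym (esym-squares≡0⇒esym≡0 Y k squares≡0 j (ℕ.<⇒≤ (ℕ.≰⇒> j≰k))))

  |padded|≡b : length (X ++ replicate (b ∸ a) 0ℤ) ≡ b
  |padded|≡b =
    trans (length-++ X) (trans (cong (a ℕ.+_) (length-replicate (b ∸ a))) (ℕ.m+[n∸m]≡n a≤b))

powSum-toList : ∀ {s} (x : Fin s → ℤ) r → powSum x r ≡ psum (toList x) r
powSum-toList {zero}  x r = refl
powSum-toList {suc s} x r = cong (_+_ (x Fin.zero ^ r)) (powSum-toList (λ i → x (Fin.suc i)) r)

short-solution⇒trivial : ∀ k {s₁ s₂} (x : Fin s₁ → ℤ) (y : Fin s₂ → ℤ) →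
                           s₁ ≤ s₂ → s₁ ℕ.+ s₂ < 2 ℕ.* k → IsSolution k x y → TrivialOrdered x y
short-solution⇒trivial k {s₁} {s₂} x y s₁≤s₂ s₁+s₂<2k sol =
  subst₂ (λ a b → toList y ↭ toList x ++ replicate (b ∸ a) 0ℤ) |x| |y|
    (short-agreement⇒trivial k (toList x) (toList y)
      (subst₂ _≤_ (sym |x|) (sym |y|) s₁≤s₂)
      (subst₂ (λ a b → a ℕ.+ b < 2 ℕ.* k) (sym |x|) (sym |y|) s₁+s₂<2k)
      (λ r 1≤r r≤k → trans (sym (powSum-toList x r)) (trans (sol r 1≤r r≤k) (powSum-toList y r))))
  where
  |x| : length (toList x) ≡ s₁
  |x| = length-tabulate x
  |y| : length (toList y) ≡ s₂
  |y| = length-tabulate y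

nontrivial⇒2k≤s₁+s₂ : ∀ k s₁ s₂ → HasNontrivialSolution k s₁ s₂ → 2 ℕ.* k ≤ s₁ ℕ.+ s₂
nontrivial⇒2k≤s₁+s₂ k s₁ s₂ (x , y , sol , nontrivial₁ , nontrivial₂)
  with 2 ℕ.* k ℕ.≤? s₁ ℕ.+ s₂ | s₁ ℕ.≤? s₂
... | yes 2k≤s | _       = 2k≤s
... | no  2k≰s | yes s₁≤s₂ =
  contradiction (short-solution⇒trivial k x y s₁≤s₂ (ℕ.≰⇒> 2k≰s) sol) (nontrivial₁ s₁≤s₂)
... | no  2k≰s | no  s₁≰s₂ =
  contradiction (short-solution⇒trivial k y x (ℕ.<⇒≤ (ℕ.≰⇒> s₁≰s₂))
                  (subst (_< 2 ℕ.* k) (ℕ.+-comm s₁ s₂) (ℕ.≰⇒> 2k≰s))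
                  (λ r 1≤r r≤k → sym (sol r 1≤r r≤k)))
                (nontrivial₂ (ℕ.≰⇒> s₁≰s₂))

isBeta-2k : ∀ k {s₁ s₂} → 1 ≤ s₁ → 1 ≤ s₂ → s₁ ℕ.+ s₂ ≡ 2 ℕ.* k →
            HasNontrivialSolution k s₁ s₂ → IsBeta k (2 ℕ.* k)
isBeta-2k k {s₁} {s₂} 1≤s₁ 1≤s₂ s≡2k solution =
  (s₁ , s₂ , 1≤s₁ , 1≤s₂ , s≡2k , solution) , λ t₁ t₂ _ _ → nontrivial⇒2k≤s₁+s₂ k t₁ t₂

nontrivial-solution : ∀ k (xs ys : List ℤ) v →
  {_ : True (ℕ.allUpTo? (λ n → psum xs (suc n) ℤ.≟ psum ys (suc n)) k)} →
  {_ : True (length xs ℕ.≤? length ys)} →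
  {_ : True (v ∈? ys)} →
  {_ : False (v ∈? xs ++ replicate (length ys ∸ length xs) 0ℤ)} →
  HasNontrivialSolution k (length xs) (length ys)
nontrivial-solution k xs ys v {sums≡} {|xs|≤|ys|} {v∈ys} {v∉padded} =
  fromList xs , fromList ys , solution , (λ _ → not-trivial) ,
  (λ |ys|<|xs| → contradiction (toWitness |xs|≤|ys|) (ℕ.<⇒≱ |ys|<|xs|))
  where
  psum-fromList : ∀ zs r → powSum (fromList zs) r ≡ psum zs r
  psum-fromList zs r =
    trans (powSum-toList (fromList zs) r) (cong (λ l → psum l r) (tabulate-lookup zs))
  solution : IsSolution k (fromList xs) (fromList ys)
  solution (suc n) _ n<k =
    trans (psum-fromList xs (suc n)) (trans (toWitness sums≡ n<k) (sym (psum-fromList ys (suc n))))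
  not-trivial : ¬ TrivialOrdered (fromList xs) (fromList ys)
  not-trivial trivial = toWitnessFalse v∉padded (∈-resp-↭ trivial′ (toWitness v∈ys))
    where
    trivial′ : ys ↭ xs ++ replicate (length ys ∸ length xs) 0ℤ
    trivial′ = subst₂ (λ l l′ → l ↭ l′ ++ replicate (length ys ∸ length xs) 0ℤ)
                      (tabulate-lookup ys) (tabulate-lookup xs) trivial

module Witnesses where
  open import Agda.Builtin.FromNat using (fromNat)
  open import Agda.Builtin.FromNeg using (fromNeg)
  open import Data.Integer.Literals as ℤ-Literals using ()
  open import Data.Nat.Literals as ℕ-Literals using ()
  open import Data.Unit using (tt)

  instance
    _ = ℕ-Literals.number
    _ = ℤ-Literals.number
    _ = ℤ-Literals.negative
    _ = tt

  solution₂ : HasNontrivialSolution 2 1 3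
  solution₂ = nontrivial-solution 2 (3 ∷ []) (2 ∷ 2 ∷ -1 ∷ []) 2

  solution₃ : HasNontrivialSolution 3 2 4
  solution₃ = nontrivial-solution 3 (-5 ∷ -5 ∷ []) (-6 ∷ -3 ∷ -2 ∷ 1 ∷ []) -6

  solution₄ : HasNontrivialSolution 4 3 5
  solution₄ = nontrivial-solution 4 (-37 ∷ 39 ∷ 62 ∷ []) (-36 ∷ -10 ∷ 12 ∷ 35 ∷ 63 ∷ []) -36

  solution₅ : HasNontrivialSolution 5 4 6
  solution₅ = nontrivial-solution 5 (-7 ∷ -7 ∷ 7 ∷ 7 ∷ []) (-8 ∷ -5 ∷ -3 ∷ 3 ∷ 5 ∷ 8 ∷ []) -8

open Witnesses

mainTheorem1 : IsBeta 2 4 × IsBeta 3 6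
    × (∃[ n ] (IsBeta 4 n × 7 ≤ n × n ≤ 8))
    × (∃[ n ] (IsBeta 5 n × 8 ≤ n × n ≤ 10))
mainTheorem1 =
  isBeta-2k 2 1≤ 1≤ refl solution₂ ,
  isBeta-2k 3 1≤ 1≤ refl solution₃ ,
  (8 , isBeta-2k 4 1≤ 1≤ refl solution₄ , ℕ.n≤1+n 7 , ℕ.≤-refl) ,
  (10 , isBeta-2k 5 1≤ 1≤ refl solution₅ , ℕ.m≤n⇒m≤1+n (ℕ.n≤1+n 8) , ℕ.≤-refl)
  where
  1≤ : ∀ {n} → 1 ≤ suc n
  1≤ = s≤s z≤n
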